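{- For every integer $g$ there exists a bipartite cubic graph of girth at least $g$ whose strong chromatic index is at least $6$.
   Context: A strong edge coloring of a graph is a proper edge coloring with no bichromatic path of length three; the strong chromatic index is the minimum number of colors in such a coloring. A cubic graph is a 3-regular graph. -}

module Defs where

open import Data.Nat using (ℕ; suc; _≤_; _<_)
open import Data.Fin using (Fin; zero; suc; inject₁; fromℕ)
open import Data.Fin.Subset using (Subset; ∣_∣)
open import Data.Vec using (tabulate)
open import Data.Bool using (Bool; true; false)
open import Data.Product using (Σ; _×_)
open import Relation.Binary.PropositionalEquality using (_≡_; _≢_)
open import Relation.Nullary using (¬_)
open import Function.Definitions using (Injective)

record Graph (n : ℕ) : Set where
  field
    adj    : Fin n → Fin n → Bool
    sym    : ∀ u v → adj u v ≡ adj v u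
    irrefl : ∀ v → adj v v ≡ false

open Graph public

Adj : ∀ {n} → Graph n → Fin n → Fin n → Set
Adj G u v = adj G u v ≡ true

N : ∀ {n} → Graph n → Fin n → Subset n
N G v = tabulate (adj G v)

degree : ∀ {n} → Graph n → Fin n → ℕ
degree G v = ∣ N G v ∣

Cubic : ∀ {n} → Graph n → Set
Cubic G = ∀ v → degree G v ≡ 3

Bipartite : ∀ {n} → Graph n → Set
Bipartite {n} G = Σ (Fin n → Bool) λ side → ∀ u v → Adj G u v → side u ≢ side v

-- a cycle of length 3 + m: pairwise distinct vertices c 0, …, c (2+m)
-- with c i ~ c (i+1) and c (2+m) ~ c 0
Cycle : ∀ {n} → Graph n → ℕ → Set
Cycle {n} G m =
  Σ (Fin (suc (suc (suc m))) → Fin n) λ c →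
    Injective _≡_ _≡_ c
    × (∀ (i : Fin (suc (suc m))) → Adj G (c (inject₁ i)) (c (suc i)))
    × Adj G (c (fromℕ (suc (suc m)))) (c zero)

GirthAtLeast : ∀ {n} → Graph n → ℕ → Set
GirthAtLeast G g = ∀ m → Cycle G m → g ≤ suc (suc (suc m))

-- an edge colouring with k colours: a colour for each (unordered) edge,
-- represented by a symmetric function on vertex pairs (values on
-- non-edges are irrelevant)
record EdgeColouring {n} (G : Graph n) (k : ℕ) : Set where
  field
    col    : Fin n → Fin n → Fin k
    colSym : ∀ u v → col u v ≡ col v u

open EdgeColouring public

Proper : ∀ {n k} {G : Graph n} → EdgeColouring G k → Set
Proper {n} {k} {G} φ =
  ∀ u v w → Adj G u v → Adj G u w → v ≢ w → col φ u v ≢ col φ u w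

-- a path of length three a - b - c - d (pairwise distinct vertices) is
-- bichromatic when (in a proper colouring) its first and last edges
-- have the same colour, i.e. it uses only two colours
NoBichromaticP3 : ∀ {n k} {G : Graph n} → EdgeColouring G k → Set
NoBichromaticP3 {n} {k} {G} φ =
  ∀ a b c d → a ≢ b → a ≢ c → a ≢ d → b ≢ c → b ≢ d → c ≢ d →
  Adj G a b → Adj G b c → Adj G c d →
  ¬ (col φ a b ≡ col φ c d)

StrongEdgeColouring : ∀ {n} → Graph n → ℕ → Set
StrongEdgeColouring G k =
  Σ (EdgeColouring G k) λ φ → Proper φ × NoBichromaticP3 φ

StrongChromaticIndexAtLeast : ∀ {n} → Graph n → ℕ → Set
StrongChromaticIndexAtLeast G s = ∀ k → k < s → ¬ StrongEdgeColouring G k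

module Submission where

-- The graph is a bipartite double cover of the Schreier graph of the matrices I + 2N modulo 2^(K+1)
-- under right multiplication by three integer involutions γ gA, γ gB, γ gC.  These generate a free
-- product Z/2 * Z/2 * Z/2 (ping-pong on three cones of ℤ²), and the entries of a product of L of
-- them are at most 3^L.  A closed reduced walk of length L yields a reduced word W and a matrix M
-- of odd determinant with M W ≡ M, hence W ≡ I, modulo 2^(K+1); if 3^L + 1 < 2^(K+1) this forces
-- W = I, which freeness rules out.  In a strong edge colouring an edge and the four edges adjacent
-- to it get five distinct colours.  With exactly five colours, fix a colour t: a vertex
-- incident with t has exactly two neighbours that are not, and a vertex not incident with t has
-- all three neighbours incident with it.  Double counting the edges between the two classes gives
-- 5 ∣ 3n, whereas the number of vertices n is a power of 2.

open import Defs hiding (sym)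
open import Data.Nat as ℕ using (ℕ; zero; suc; _≤_; _^_; z≤n; s≤s; NonZero)
import Data.Nat.Properties as ℕ
open import Data.Fin as Fin using (Fin; toℕ; fromℕ<; inject₁; fromℕ; punchOut)
import Data.Fin.Properties as Fin
open import Data.Fin.Properties using (_≟_; punchOut-injective)
open import Data.Product using (Σ; _×_; _,_; proj₁; proj₂)
open import Data.Sum using (_⊎_; inj₁; inj₂)
open import Data.List using (List; []; _∷_; length)
open import Function using (_∘_)
open import Relation.Binary.PropositionalEquality
open import Relation.Nullary using (¬_; Dec; yes; no; contradiction)

module IntegerCongruences where

  open import Data.Integer using (ℤ; +_; _+_; _*_; -_; _-_; ∣_∣; 0ℤ; 1ℤ)
  import Data.Integer.Properties as ℤ
  open import Data.Integer.Divisibility.Signed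
  open import Data.Integer.DivMod using (_%ℕ_; _/ℕ_; n%ℕd<d; a≡a%ℕn+[a/ℕn]*n)
  open import Data.Integer.Tactic.RingSolver using (solve)
  import Data.Nat.Divisibility as ℕ

  infix 4 _≡_mod_
  record _≡_mod_ (x y q : ℤ) : Set where
    constructor ≡-mod
    field
      ∣-difference : q ∣ x - y

  private
    affine-difference : ∀ c x y → + 2 * (x - y) ≡ (c + + 2 * x) - (c + + 2 * y)
    affine-difference c x y = solve (c ∷ x ∷ y ∷ [])

  module _ {q : ℤ} where

    ≡-mod-reflexive : ∀ {x y} → x ≡ y → x ≡ y mod q
    ≡-mod-reflexive {x} refl = ≡-mod (divides 0ℤ (trans (ℤ.+-inverseʳ x) (sym (ℤ.*-zeroˡ q))))

    ≡-mod-refl : ∀ {x} → x ≡ x mod q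
    ≡-mod-refl {x} = ≡-mod-reflexive {x} refl

    ≡-mod-sym : ∀ {x y} → x ≡ y mod q → y ≡ x mod q
    ≡-mod-sym {x} {y} (≡-mod q∣x-y) = ≡-mod (subst (q ∣_) eq (∣m⇒∣-m q∣x-y))
      where
      eq : - (x - y) ≡ y - x
      eq = solve (x ∷ y ∷ [])

    ≡-mod-trans : ∀ {x y z} → x ≡ y mod q → y ≡ z mod q → x ≡ z mod q
    ≡-mod-trans {x} {y} {z} (≡-mod q∣x-y) (≡-mod q∣y-z) = ≡-mod (subst (q ∣_) eq (∣m∣n⇒∣m+n q∣x-y q∣y-z))
      where
      eq : (x - y) + (y - z) ≡ x - z
      eq = solve (x ∷ y ∷ z ∷ [])

    +-cong-mod : ∀ {x y x′ y′} → x ≡ y mod q → x′ ≡ y′ mod q → x + x′ ≡ y + y′ mod q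
    +-cong-mod {x} {y} {x′} {y′} (≡-mod q∣x-y) (≡-mod q∣x′-y′) =
      ≡-mod (subst (q ∣_) eq (∣m∣n⇒∣m+n q∣x-y q∣x′-y′))
      where
      eq : (x - y) + (x′ - y′) ≡ (x + x′) - (y + y′)
      eq = solve (x ∷ y ∷ x′ ∷ y′ ∷ [])

    *-cong-mod : ∀ {x y x′ y′} → x ≡ y mod q → x′ ≡ y′ mod q → x * x′ ≡ y * y′ mod q
    *-cong-mod {x} {y} {x′} {y′} (≡-mod q∣x-y) (≡-mod q∣x′-y′) =
      ≡-mod (subst (q ∣_) eq (∣m∣n⇒∣m+n (∣m⇒∣m*n x′ q∣x-y) (∣n⇒∣m*n y q∣x′-y′)))
      where
      eq : (x - y) * x′ + y * (x′ - y′) ≡ x * x′ - y * y′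
      eq = solve (x ∷ y ∷ x′ ∷ y′ ∷ [])

    affine-cong-mod : ∀ c {x y} → x ≡ y mod q → c + + 2 * x ≡ c + + 2 * y mod + 2 * q
    affine-cong-mod c {x} {y} (≡-mod q∣x-y) = ≡-mod (subst (+ 2 * q ∣_) (affine-difference c x y) (*-monoʳ-∣ (+ 2) q∣x-y))

    affine-cancel-mod : ∀ c {x y} → c + + 2 * x ≡ c + + 2 * y mod + 2 * q → x ≡ y mod q
    affine-cancel-mod c {x} {y} (≡-mod 2q∣2x-2y) =
      ≡-mod (*-cancelˡ-∣ (+ 2) (subst (+ 2 * q ∣_) (sym (affine-difference c x y)) 2q∣2x-2y))

  ≡-mod-small⇒≡ : ∀ {q x y} → x ≡ y mod q → ∣ x - y ∣ ℕ.< ∣ q ∣ → x ≡ y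
  ≡-mod-small⇒≡ {q} {x} {y} (≡-mod q∣x-y) small with ∣ x - y ∣ in eq
  ... | zero  = ℤ.i-j≡0⇒i≡j x y (ℤ.∣i∣≡0⇒i≡0 eq)
  ... | suc k = contradiction (ℕ.∣⇒≤ (subst (ℕ._∣_ ∣ q ∣) eq (∣⇒∣ᵤ q∣x-y))) (ℕ.<⇒≱ small)

  module _ (q : ℕ) .{{_ : NonZero q}} where

    reduce : ℤ → Fin q
    reduce x = fromℕ< (n%ℕd<d x q)

    ≡-mod-reduce : ∀ x → x ≡ + toℕ (reduce x) mod + q
    ≡-mod-reduce x = ≡-mod (divides (x /ℕ q) (begin
      x - + toℕ (reduce x)                    ≡⟨ cong (λ r → x - + r) (Fin.toℕ-fromℕ< (n%ℕd<d x q)) ⟩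
      x - + (x %ℕ q)                          ≡⟨ cong (_- + (x %ℕ q)) (a≡a%ℕn+[a/ℕn]*n x q) ⟩
      + (x %ℕ q) + x /ℕ q * + q - + (x %ℕ q)  ≡⟨ r+s-r≡s (+ (x %ℕ q)) (x /ℕ q * + q) ⟩
      x /ℕ q * + q                            ∎))
      where
      open ≡-Reasoning
      r+s-r≡s : ∀ r s → r + s - r ≡ s
      r+s-r≡s r s = solve (r ∷ s ∷ [])

  toℕ-cong-mod⇒≡ : ∀ {q} {i j : Fin q} → + toℕ i ≡ + toℕ j mod + q → i ≡ j
  toℕ-cong-mod⇒≡ {q} {i} {j} i≡j = Fin.toℕ-injective (ℤ.+-injective (≡-mod-small⇒≡ i≡j small))
    where
    small : ∣ + toℕ i - + toℕ j ∣ ℕ.< q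
    small = ℕ.≤-<-trans (subst (ℕ._≤ toℕ i ℕ.⊔ toℕ j) (cong ∣_∣ (sym (ℤ.m-n≡m⊖n (toℕ i) (toℕ j))))
                                 (ℤ.∣m⊝n∣≤m⊔n (toℕ i) (toℕ j)))
                       (ℕ.⊔-lub (Fin.toℕ<n i) (Fin.toℕ<n j))

  odd-*-cancel-2^ : ∀ j h z → + (2 ^ j) ∣ (1ℤ + + 2 * h) * z → + (2 ^ j) ∣ z
  odd-*-cancel-2^ zero    h z _ = divides z (sym (ℤ.*-identityʳ z))
  odd-*-cancel-2^ (suc j) h z 2^[1+j]∣dz with ∣m+n∣n⇒∣m {m = z} 2∣z+2hz (∣m⇒∣m*n (h * z) ∣-refl)
    where
    2∣z+2hz : + 2 ∣ z + + 2 * (h * z)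
    2∣z+2hz = subst (+ 2 ∣_) (odd-expand h z) (∣-trans (∣ᵤ⇒∣ (ℕ.m∣m*n (2 ^ j))) 2^[1+j]∣dz)
      where
      odd-expand : ∀ h z → (1ℤ + + 2 * h) * z ≡ z + + 2 * (h * z)
      odd-expand h z = solve (h ∷ z ∷ [])
  ... | divides z′ refl =
    subst₂ _∣_ (sym (ℤ.pos-* 2 (2 ^ j))) (ℤ.*-comm (+ 2) z′)
      (*-monoʳ-∣ (+ 2) (odd-*-cancel-2^ j h z′ (*-cancelˡ-∣ (+ 2) 2·2^j∣2dz′)))
    where
    2·2^j∣2dz′ : + 2 * + (2 ^ j) ∣ + 2 * ((1ℤ + + 2 * h) * z′)
    2·2^j∣2dz′ = subst₂ _∣_ (ℤ.pos-* 2 (2 ^ j)) (shuffle (1ℤ + + 2 * h) z′) 2^[1+j]∣dz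
      where
      shuffle : ∀ d z′ → d * (z′ * + 2) ≡ + 2 * (d * z′)
      shuffle d z′ = solve (d ∷ z′ ∷ [])

  odd-cancel-mod-2^ : ∀ j h {x y} → (1ℤ + + 2 * h) * x ≡ (1ℤ + + 2 * h) * y mod + (2 ^ j) → x ≡ y mod + (2 ^ j)
  odd-cancel-mod-2^ j h {x} {y} (≡-mod 2^j∣dx-dy) = ≡-mod (odd-*-cancel-2^ j h (x - y) (subst (+ (2 ^ j) ∣_) eq 2^j∣dx-dy))
    where
    eq : (1ℤ + + 2 * h) * x - (1ℤ + + 2 * h) * y ≡ (1ℤ + + 2 * h) * (x - y)
    eq = solve (h ∷ x ∷ y ∷ [])

open IntegerCongruences

module IntegerMatrices where

  open import Data.Integer using (ℤ; +_; _+_; _*_; -_; _-_; 0ℤ; 1ℤ)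
  open import Data.Integer.Tactic.RingSolver using (solve-∀)
  open import Level using (0ℓ)
  open import Relation.Binary.Bundles using (Setoid)
  import Relation.Binary.Reasoning.Setoid as SetoidReasoning

  record Mat₂ (A : Set) : Set where
    constructor mat
    field e₁₁ e₁₂ e₂₁ e₂₂ : A
  open Mat₂

  mat-cong : ∀ {A : Set} {a b c d a′ b′ c′ d′ : A} →
    a ≡ a′ → b ≡ b′ → c ≡ c′ → d ≡ d′ → mat a b c d ≡ mat a′ b′ c′ d′
  mat-cong refl refl refl refl = refl

  AllEntries : ∀ {A : Set} → (A → Set) → Mat₂ A → Set
  AllEntries P (mat a b c d) = P a × P b × P c × P d

  map₂ : ∀ {A B : Set} → (A → B) → Mat₂ A → Mat₂ B
  map₂ h (mat a b c d) = mat (h a) (h b) (h c) (h d)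

  Mat : Set
  Mat = Mat₂ ℤ

  I : Mat
  I = mat 1ℤ 0ℤ 0ℤ 1ℤ

  infixl 6 _+ᴹ_
  infixl 7 _*ᴹ_ _•_

  _+ᴹ_ : Mat → Mat → Mat
  mat a b c d +ᴹ mat a′ b′ c′ d′ = mat (a + a′) (b + b′) (c + c′) (d + d′)

  _•_ : ℤ → Mat → Mat
  k • mat a b c d = mat (k * a) (k * b) (k * c) (k * d)

  _*ᴹ_ : Mat → Mat → Mat
  mat a b c d *ᴹ mat a′ b′ c′ d′ =
    mat (a * a′ + b * c′) (a * b′ + b * d′) (c * a′ + d * c′) (c * b′ + d * d′)

  det : Mat → ℤ
  det (mat a b c d) = a * d - b * c

  adjugate : Mat → Mat
  adjugate (mat a b c d) = mat d (- b) (- c) a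

  *ᴹ-assoc : ∀ A B C → (A *ᴹ B) *ᴹ C ≡ A *ᴹ (B *ᴹ C)
  *ᴹ-assoc (mat a b c d) (mat a′ b′ c′ d′) (mat a″ b″ c″ d″) =
    mat-cong (row a b a″ c″) (row a b b″ d″) (row c d a″ c″) (row c d b″ d″)
    where
    row : ∀ a b x y → (a * a′ + b * c′) * x + (a * b′ + b * d′) * y ≡ a * (a′ * x + b′ * y) + b * (c′ * x + d′ * y)
    row a b x y = lemma a b a′ b′ c′ d′ x y
      where
      lemma : ∀ a b a′ b′ c′ d′ x y →
        (a * a′ + b * c′) * x + (a * b′ + b * d′) * y ≡ a * (a′ * x + b′ * y) + b * (c′ * x + d′ * y)
      lemma = solve-∀

  *ᴹ-identityʳ : ∀ A → A *ᴹ I ≡ A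
  *ᴹ-identityʳ (mat a b c d) = mat-cong (first a b) (second a b) (first c d) (second c d)
    where
    first : ∀ x y → x * 1ℤ + y * 0ℤ ≡ x
    first = solve-∀
    second : ∀ x y → x * 0ℤ + y * 1ℤ ≡ y
    second = solve-∀

  adjugate-*ᴹ : ∀ A B → adjugate A *ᴹ (A *ᴹ B) ≡ det A • B
  adjugate-*ᴹ (mat a b c d) (mat p q r s) = mat-cong (top a b c d p r) (top a b c d q s) (bottom a b c d p r) (bottom a b c d q s)
    where
    top : ∀ a b c d p r → d * (a * p + b * r) + - b * (c * p + d * r) ≡ (a * d - b * c) * p
    top = solve-∀
    bottom : ∀ a b c d p r → - c * (a * p + b * r) + a * (c * p + d * r) ≡ (a * d - b * c) * r
    bottom = solve-∀

  det-I+2• : ∀ N → det (I +ᴹ + 2 • N) ≡ 1ℤ + + 2 * (e₁₁ N + e₂₂ N + + 2 * det N)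
  det-I+2• (mat a b c d) = lemma a b c d
    where
    lemma : ∀ a b c d → (1ℤ + + 2 * a) * (1ℤ + + 2 * d) - (0ℤ + + 2 * b) * (0ℤ + + 2 * c)
                        ≡ 1ℤ + + 2 * (a + d + + 2 * (a * d - b * c))
    lemma = solve-∀

  I+2•-*ᴹ : ∀ N X → (I +ᴹ + 2 • N) *ᴹ (I +ᴹ + 2 • X) ≡ I +ᴹ + 2 • (N +ᴹ X +ᴹ + 2 • (N *ᴹ X))
  I+2•-*ᴹ (mat a b c d) (mat x y z w) =
    mat-cong (diagonal a b x z) (off-diagonal a b y w) (off-diagonal′ c d x z) (diagonal′ c d y w)
    where
    diagonal : ∀ a b x z →
      (1ℤ + + 2 * a) * (1ℤ + + 2 * x) + (0ℤ + + 2 * b) * (0ℤ + + 2 * z) ≡ 1ℤ + + 2 * (a + x + + 2 * (a * x + b * z))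
    diagonal = solve-∀
    off-diagonal : ∀ a b y w →
      (1ℤ + + 2 * a) * (0ℤ + + 2 * y) + (0ℤ + + 2 * b) * (1ℤ + + 2 * w) ≡ 0ℤ + + 2 * (b + y + + 2 * (a * y + b * w))
    off-diagonal = solve-∀
    off-diagonal′ : ∀ c d x z →
      (0ℤ + + 2 * c) * (1ℤ + + 2 * x) + (1ℤ + + 2 * d) * (0ℤ + + 2 * z) ≡ 0ℤ + + 2 * (c + z + + 2 * (c * x + d * z))
    off-diagonal′ = solve-∀
    diagonal′ : ∀ c d y w →
      (0ℤ + + 2 * c) * (0ℤ + + 2 * y) + (1ℤ + + 2 * d) * (1ℤ + + 2 * w) ≡ 1ℤ + + 2 * (d + w + + 2 * (c * y + d * w))
    diagonal′ = solve-∀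

  infix 4 _≡ᴹ_mod_
  record _≡ᴹ_mod_ (A B : Mat) (q : ℤ) : Set where
    constructor entrywise
    field
      ≡₁₁ : e₁₁ A ≡ e₁₁ B mod q
      ≡₁₂ : e₁₂ A ≡ e₁₂ B mod q
      ≡₂₁ : e₂₁ A ≡ e₂₁ B mod q
      ≡₂₂ : e₂₂ A ≡ e₂₂ B mod q

  ≡ᴹ-mod-cast : ∀ {A B q q′} → q ≡ q′ → A ≡ᴹ B mod q → A ≡ᴹ B mod q′
  ≡ᴹ-mod-cast refl A≡B = A≡B

  module _ {q : ℤ} where

    ≡ᴹ-mod-reflexive : ∀ {A B} → A ≡ B → A ≡ᴹ B mod q
    ≡ᴹ-mod-reflexive {mat a b c d} refl =
      entrywise (≡-mod-refl {x = a}) (≡-mod-refl {x = b}) (≡-mod-refl {x = c}) (≡-mod-refl {x = d})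

    ≡ᴹ-mod-refl : ∀ {A} → A ≡ᴹ A mod q
    ≡ᴹ-mod-refl = ≡ᴹ-mod-reflexive refl

    ≡ᴹ-mod-sym : ∀ {A B} → A ≡ᴹ B mod q → B ≡ᴹ A mod q
    ≡ᴹ-mod-sym (entrywise a b c d) = entrywise (≡-mod-sym a) (≡-mod-sym b) (≡-mod-sym c) (≡-mod-sym d)

    ≡ᴹ-mod-trans : ∀ {A B C} → A ≡ᴹ B mod q → B ≡ᴹ C mod q → A ≡ᴹ C mod q
    ≡ᴹ-mod-trans (entrywise a b c d) (entrywise a′ b′ c′ d′) =
      entrywise (≡-mod-trans a a′) (≡-mod-trans b b′) (≡-mod-trans c c′) (≡-mod-trans d d′)

    *ᴹ-cong-mod : ∀ {A A′ B B′} → A ≡ᴹ A′ mod q → B ≡ᴹ B′ mod q → A *ᴹ B ≡ᴹ A′ *ᴹ B′ mod q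
    *ᴹ-cong-mod {mat _ _ _ _} {mat _ _ _ _} {mat _ _ _ _} {mat _ _ _ _} (entrywise a b c d) (entrywise a′ b′ c′ d′) =
      entrywise (+-cong-mod (*-cong-mod a a′) (*-cong-mod b c′)) (+-cong-mod (*-cong-mod a b′) (*-cong-mod b d′))
                (+-cong-mod (*-cong-mod c a′) (*-cong-mod d c′)) (+-cong-mod (*-cong-mod c b′) (*-cong-mod d d′))

    I+2•-cong-mod : ∀ {N N′} → N ≡ᴹ N′ mod q → I +ᴹ + 2 • N ≡ᴹ I +ᴹ + 2 • N′ mod + 2 * q
    I+2•-cong-mod {mat _ _ _ _} {mat _ _ _ _} (entrywise a b c d) =
      entrywise (affine-cong-mod 1ℤ a) (affine-cong-mod 0ℤ b) (affine-cong-mod 0ℤ c) (affine-cong-mod 1ℤ d)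

    I+2•-cancel-mod : ∀ {N N′} → I +ᴹ + 2 • N ≡ᴹ I +ᴹ + 2 • N′ mod + 2 * q → N ≡ᴹ N′ mod q
    I+2•-cancel-mod {mat _ _ _ _} {mat _ _ _ _} (entrywise a b c d) =
      entrywise (affine-cancel-mod 1ℤ a) (affine-cancel-mod 0ℤ b) (affine-cancel-mod 0ℤ c) (affine-cancel-mod 1ℤ d)

  ≡ᴹ-mod-setoid : ℤ → Setoid 0ℓ 0ℓ
  ≡ᴹ-mod-setoid q = record
    { Carrier       = Mat
    ; _≈_           = λ A B → A ≡ᴹ B mod q
    ; isEquivalence = record { refl = ≡ᴹ-mod-refl ; sym = ≡ᴹ-mod-sym ; trans = ≡ᴹ-mod-trans }
    }

  odd-det-cancel-mod-2^ : ∀ j h {A B C} → det A ≡ 1ℤ + + 2 * h →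
    A *ᴹ B ≡ᴹ A *ᴹ C mod + (2 ^ j) → B ≡ᴹ C mod + (2 ^ j)
  odd-det-cancel-mod-2^ j h {A} {B} {C} detA≡ AB≡AC =
    odd-cancel (subst (λ d → d • B ≡ᴹ d • C mod + (2 ^ j)) detA≡ detA•B≡detA•C)
    where
    open SetoidReasoning (≡ᴹ-mod-setoid (+ (2 ^ j)))
    detA•B≡detA•C : det A • B ≡ᴹ det A • C mod + (2 ^ j)
    detA•B≡detA•C = begin
      det A • B               ≡⟨ adjugate-*ᴹ A B ⟨
      adjugate A *ᴹ (A *ᴹ B)  ≈⟨ *ᴹ-cong-mod (≡ᴹ-mod-refl {A = adjugate A}) AB≡AC ⟩
      adjugate A *ᴹ (A *ᴹ C)  ≡⟨ adjugate-*ᴹ A C ⟩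
      det A • C               ∎
    odd-cancel : ∀ {B C} → (1ℤ + + 2 * h) • B ≡ᴹ (1ℤ + + 2 * h) • C mod + (2 ^ j) → B ≡ᴹ C mod + (2 ^ j)
    odd-cancel {mat _ _ _ _} {mat _ _ _ _} (entrywise a b c d) =
      entrywise (odd-cancel-mod-2^ j h a) (odd-cancel-mod-2^ j h b) (odd-cancel-mod-2^ j h c) (odd-cancel-mod-2^ j h d)

open IntegerMatrices

module FreeProduct where

  open import Data.List.Relation.Unary.Linked using (Linked; [-]; _∷_)
  open import Data.Integer using (ℤ; +_; _+_; _*_; -_; _-_; ∣_∣; 0ℤ; 1ℤ; -1ℤ; _<_; +<+)
  import Data.Integer.Properties as ℤ
  open import Data.Integer.Tactic.RingSolver using (solve-∀)
  open import Data.Empty using (⊥)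
  open import Relation.Binary.Definitions using (DecidableEquality)
  open Mat₂

  data Gen : Set where
    gA gB gC : Gen

  _≟ᴳ_ : DecidableEquality Gen
  gA ≟ᴳ gA = yes refl
  gA ≟ᴳ gB = no λ ()
  gA ≟ᴳ gC = no λ ()
  gB ≟ᴳ gA = no λ ()
  gB ≟ᴳ gB = yes refl
  gB ≟ᴳ gC = no λ ()
  gC ≟ᴳ gA = no λ ()
  gC ≟ᴳ gB = no λ ()
  gC ≟ᴳ gC = yes refl

  X : Gen → Mat
  X gA = mat -1ℤ 0ℤ 0ℤ 0ℤ
  X gB = mat -1ℤ 1ℤ 0ℤ 0ℤ
  X gC = mat 0ℤ 0ℤ 1ℤ -1ℤ

  γ : Gen → Mat
  γ x = I +ᴹ + 2 • X x

  γ-involutive : ∀ x → γ x *ᴹ γ x ≡ I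
  γ-involutive gA = refl
  γ-involutive gB = refl
  γ-involutive gC = refl

  eval : List Gen → Mat
  eval []      = I
  eval (x ∷ w) = γ x *ᴹ eval w

  Vec₂ : Set
  Vec₂ = ℤ × ℤ

  infixr 5 _∙_
  _∙_ : Mat → Vec₂ → Vec₂
  mat a b c d ∙ (u , v) = a * u + b * v , c * u + d * v

  neg : Vec₂ → Vec₂
  neg (u , v) = - u , - v

  *ᴹ-∙ : ∀ A B p → (A *ᴹ B) ∙ p ≡ A ∙ B ∙ p
  *ᴹ-∙ (mat a b c d) (mat a′ b′ c′ d′) (u , v) = cong₂ _,_ (row a b c′ d′) (row c d c′ d′)
    where
    row : ∀ a b c′ d′ → (a * a′ + b * c′) * u + (a * b′ + b * d′) * v ≡ a * (a′ * u + b′ * v) + b * (c′ * u + d′ * v)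
    row a b c′ d′ = lemma a b a′ b′ c′ d′ u v
      where
      lemma : ∀ a b a′ b′ c′ d′ u v →
        (a * a′ + b * c′) * u + (a * b′ + b * d′) * v ≡ a * (a′ * u + b′ * v) + b * (c′ * u + d′ * v)
      lemma = solve-∀

  I-∙ : ∀ p → I ∙ p ≡ p
  I-∙ (u , v) = cong₂ _,_ (first u v) (second u v)
    where
    first : ∀ u v → 1ℤ * u + 0ℤ * v ≡ u
    first = solve-∀
    second : ∀ u v → 0ℤ * u + 1ℤ * v ≡ v
    second = solve-∀

  ∙-neg : ∀ A p → A ∙ neg p ≡ neg (A ∙ p)
  ∙-neg (mat a b c d) (u , v) = cong₂ _,_ (row a b) (row c d)
    where
    row : ∀ a b → a * - u + b * - v ≡ - (a * u + b * v)
    row a b = lemma a b u v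
      where
      lemma : ∀ a b u v → a * - u + b * - v ≡ - (a * u + b * v)
      lemma = solve-∀

  neg-involutive : ∀ p → neg (neg p) ≡ p
  neg-involutive (u , v) = cong₂ _,_ (ℤ.neg-involutive u) (ℤ.neg-involutive v)

  -- Up to sign, the three cones are disjoint open arcs of the projective line, and γ x
  -- maps the arcs of the other two generators into its own.
  Cone : Gen → Vec₂ → Set
  Cone gA (u , v) = 0ℤ < v × 0ℤ < - u
  Cone gB (u , v) = 0ℤ < v × 0ℤ < u - v
  Cone gC (u , v) = 0ℤ < u × 0ℤ < v - u

  Region : Gen → Vec₂ → Set
  Region x p = Cone x p ⊎ Cone x (neg p)

  private
    pos-+ : ∀ {a b} → 0ℤ < a → 0ℤ < b → 0ℤ < a + b
    pos-+ = ℤ.+-mono-<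

    pos-≡ : ∀ {a b} → a ≡ b → 0ℤ < a → 0ℤ < b
    pos-≡ refl 0<a = 0<a

    pos-+-≢0 : ∀ {a b} → 0ℤ < a → 0ℤ < b → a + b ≡ 0ℤ → ⊥
    pos-+-≢0 0<a 0<b a+b≡0 = ℤ.<-irrefl (sym a+b≡0) (pos-+ 0<a 0<b)

    0<1 : 0ℤ < 1ℤ
    0<1 = +<+ (s≤s z≤n)

  reflection : Gen → ℤ → ℤ → Vec₂
  reflection gA u v = - u , v
  reflection gB u v = - u + + 2 * v , v
  reflection gC u v = u , + 2 * u - v

  γ-∙ : ∀ x u v → γ x ∙ (u , v) ≡ reflection x u v
  γ-∙ gA u v = cong₂ _,_ (first u v) (second u v)
    where
    first : ∀ u v → -1ℤ * u + 0ℤ * v ≡ - u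
    first = solve-∀
    second : ∀ u v → 0ℤ * u + 1ℤ * v ≡ v
    second = solve-∀
  γ-∙ gB u v = cong₂ _,_ (first u v) (second u v)
    where
    first : ∀ u v → -1ℤ * u + + 2 * v ≡ - u + + 2 * v
    first = solve-∀
    second : ∀ u v → 0ℤ * u + 1ℤ * v ≡ v
    second = solve-∀
  γ-∙ gC u v = cong₂ _,_ (first u v) (second u v)
    where
    first : ∀ u v → 1ℤ * u + 0ℤ * v ≡ u
    first = solve-∀
    second : ∀ u v → + 2 * u + -1ℤ * v ≡ + 2 * u - v
    second = solve-∀

  reflection-into-cone : ∀ x y u v → x ≢ y → Cone y (u , v) → Region x (reflection x u v)
  reflection-into-cone gA gA u v x≢y _ = contradiction refl x≢y
  reflection-into-cone gA gB u v _ (0<v , 0<u-v) = inj₁ (0<v , pos-≡ (eq u v) (pos-+ 0<u-v 0<v))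
    where
    eq : ∀ u v → (u - v) + v ≡ - - u
    eq = solve-∀
  reflection-into-cone gA gC u v _ (0<u , 0<v-u) = inj₁ (pos-≡ (eq u v) (pos-+ 0<v-u 0<u) , pos-≡ (sym (ℤ.neg-involutive u)) 0<u)
    where
    eq : ∀ u v → (v - u) + u ≡ v
    eq = solve-∀
  reflection-into-cone gB gA u v _ (0<v , 0<-u) = inj₁ (0<v , pos-≡ (eq u v) (pos-+ 0<-u 0<v))
    where
    eq : ∀ u v → - u + v ≡ (- u + + 2 * v) - v
    eq = solve-∀
  reflection-into-cone gB gB u v x≢y _ = contradiction refl x≢y
  reflection-into-cone gB gC u v _ (0<u , 0<v-u) = inj₁ (pos-≡ (eq₁ u v) (pos-+ 0<v-u 0<u) , pos-≡ (eq₂ u v) 0<v-u)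
    where
    eq₁ : ∀ u v → (v - u) + u ≡ v
    eq₁ = solve-∀
    eq₂ : ∀ u v → v - u ≡ (- u + + 2 * v) - v
    eq₂ = solve-∀
  reflection-into-cone gC gA u v _ (0<v , 0<-u) = inj₂ (0<-u , pos-≡ (eq u v) (pos-+ 0<v 0<-u))
    where
    eq : ∀ u v → v + - u ≡ - (+ 2 * u - v) - - u
    eq = solve-∀
  reflection-into-cone gC gB u v _ (0<v , 0<u-v) = inj₁ (pos-≡ (eq₁ u v) (pos-+ 0<u-v 0<v) , pos-≡ (eq₂ u v) 0<u-v)
    where
    eq₁ : ∀ u v → (u - v) + v ≡ u
    eq₁ = solve-∀
    eq₂ : ∀ u v → u - v ≡ (+ 2 * u - v) - u
    eq₂ = solve-∀
  reflection-into-cone gC gC u v x≢y _ = contradiction refl x≢y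

  Region-neg : ∀ {x} p → Region x p → Region x (neg p)
  Region-neg {x} p (inj₁ c) = inj₂ (subst (Cone x) (sym (neg-involutive p)) c)
  Region-neg p (inj₂ c) = inj₁ c

  ping-pong-step : ∀ {x y} p → x ≢ y → Region y p → Region x (γ x ∙ p)
  ping-pong-step {x} {y} (u , v) x≢y (inj₁ c) = subst (Region x) (sym (γ-∙ x u v)) (reflection-into-cone x y u v x≢y c)
  ping-pong-step {x} p x≢y (inj₂ c) =
    subst (Region x) (neg-involutive _)
      (Region-neg _ (subst (Region x) (∙-neg (γ x) p) (ping-pong-step (neg p) x≢y (inj₁ c))))

  Cone⇒0<snd : ∀ x u v → Cone x (u , v) → 0ℤ < v
  Cone⇒0<snd gA u v (0<v , _) = 0<v
  Cone⇒0<snd gB u v (0<v , _) = 0<v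
  Cone⇒0<snd gC u v (0<u , 0<v-u) = pos-≡ (eq u v) (pos-+ 0<v-u 0<u)
    where
    eq : ∀ u v → (v - u) + u ≡ v
    eq = solve-∀

  Cone-disjoint : ∀ x y p → Cone x p → Cone y p → x ≡ y
  Cone-disjoint gA gA _ _ _ = refl
  Cone-disjoint gA gB (u , v) (_ , 0<-u) (0<v , 0<u-v) = contradiction (eq u v) (pos-+-≢0 (pos-+ 0<-u 0<u-v) 0<v)
    where
    eq : ∀ u v → (- u + (u - v)) + v ≡ 0ℤ
    eq = solve-∀
  Cone-disjoint gA gC (u , v) (_ , 0<-u) (0<u , _) = contradiction (ℤ.+-inverseˡ u) (pos-+-≢0 0<-u 0<u)
  Cone-disjoint gB gB _ _ _ = refl
  Cone-disjoint gB gC (u , v) (_ , 0<u-v) (_ , 0<v-u) = contradiction (eq u v) (pos-+-≢0 0<u-v 0<v-u)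
    where
    eq : ∀ u v → (u - v) + (v - u) ≡ 0ℤ
    eq = solve-∀
  Cone-disjoint gC gC _ _ _ = refl
  Cone-disjoint gB gA p cx cy = sym (Cone-disjoint gA gB p cy cx)
  Cone-disjoint gC gA p cx cy = sym (Cone-disjoint gA gC p cy cx)
  Cone-disjoint gC gB p cx cy = sym (Cone-disjoint gB gC p cy cx)

  Region-disjoint : ∀ {x y} p → Region x p → Region y p → x ≡ y
  Region-disjoint {x} {y} p (inj₁ cx) (inj₁ cy) = Cone-disjoint x y p cx cy
  Region-disjoint {x} {y} p (inj₂ cx) (inj₂ cy) = Cone-disjoint x y (neg p) cx cy
  Region-disjoint {x} {y} (u , v) (inj₁ cx) (inj₂ cy) =
    contradiction (ℤ.+-inverseʳ v) (pos-+-≢0 (Cone⇒0<snd x u v cx) (Cone⇒0<snd y (- u) (- v) cy))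
  Region-disjoint {x} {y} (u , v) (inj₂ cx) (inj₁ cy) =
    contradiction (ℤ.+-inverseʳ v) (pos-+-≢0 (Cone⇒0<snd y u v cy) (Cone⇒0<snd x (- u) (- v) cx))

  lastOf : Gen → List Gen → Gen
  lastOf x []      = x
  lastOf _ (y ∷ w) = lastOf y w

  ping-pong : ∀ {x w y} p → Linked _≢_ (x ∷ w) → y ≢ lastOf x w → Region y p → Region x (eval (x ∷ w) ∙ p)
  ping-pong {x} {[]} p [-] y≢x r =
    subst (Region x) (cong (_∙ p) (sym (*ᴹ-identityʳ (γ x)))) (ping-pong-step p (y≢x ∘ sym) r)
  ping-pong {x} {x′ ∷ w} p (x≢x′ ∷ reduced) y≢last r =
    subst (Region x) (sym (*ᴹ-∙ (γ x) (eval (x′ ∷ w)) p)) (ping-pong-step _ x≢x′ (ping-pong p reduced y≢last r))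

  other : Gen → Gen → Gen
  other gA gB = gC
  other gA _  = gB
  other gB gA = gC
  other gB _  = gA
  other gC gA = gB
  other gC _  = gA

  other-≢ : ∀ x y → other x y ≢ x × other x y ≢ y
  other-≢ gA gA = (λ ()) , (λ ())
  other-≢ gA gB = (λ ()) , (λ ())
  other-≢ gA gC = (λ ()) , (λ ())
  other-≢ gB gA = (λ ()) , (λ ())
  other-≢ gB gB = (λ ()) , (λ ())
  other-≢ gB gC = (λ ()) , (λ ())
  other-≢ gC gA = (λ ()) , (λ ())
  other-≢ gC gB = (λ ()) , (λ ())
  other-≢ gC gC = (λ ()) , (λ ())

  point-in : ∀ x → Σ Vec₂ (Region x)
  point-in gA = (-1ℤ , 1ℤ) , inj₁ (0<1 , 0<1)
  point-in gB = (+ 2 , 1ℤ) , inj₁ (0<1 , 0<1)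
  point-in gC = (1ℤ , + 2) , inj₁ (0<1 , 0<1)

  eval-reduced≢I : ∀ {x w} → Linked _≢_ (x ∷ w) → eval (x ∷ w) ≢ I
  eval-reduced≢I {x} {w} reduced eval≡I =
    proj₁ (other-≢ x z) (sym (Region-disjoint p p∈Region-x p∈Region-y))
    where
    z y : Gen
    z = lastOf x w
    y = other x z
    p : Vec₂
    p = proj₁ (point-in y)
    p∈Region-y : Region y p
    p∈Region-y = proj₂ (point-in y)
    p∈Region-x : Region x p
    p∈Region-x = subst (Region x) (trans (cong (_∙ p) eval≡I) (I-∙ p)) (ping-pong p reduced (proj₂ (other-≢ x z)) p∈Region-y)

  RowSums≤ : ℕ → Mat → Set
  RowSums≤ k (mat a b c d) = ∣ a ∣ ℕ.+ ∣ b ∣ ℕ.≤ k × ∣ c ∣ ℕ.+ ∣ d ∣ ℕ.≤ k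

  EntriesBounded : ℕ → Mat → Set
  EntriesBounded B = AllEntries (λ e → ∣ e ∣ ℕ.≤ B)

  γ-rowSums≤3 : ∀ x → RowSums≤ 3 (γ x)
  γ-rowSums≤3 gA = s≤s z≤n , s≤s z≤n
  γ-rowSums≤3 gB = s≤s (s≤s (s≤s z≤n)) , s≤s z≤n
  γ-rowSums≤3 gC = s≤s z≤n , s≤s (s≤s (s≤s z≤n))

  *ᴹ-entriesBounded : ∀ {k B} G W → RowSums≤ k G → EntriesBounded B W → EntriesBounded (k ℕ.* B) (G *ᴹ W)
  *ᴹ-entriesBounded {k} {B} (mat a b c d) (mat p q r s) (row₁ , row₂) (p≤ , q≤ , r≤ , s≤) =
    entry a b p r row₁ p≤ r≤ , entry a b q s row₁ q≤ s≤ , entry c d p r row₂ p≤ r≤ , entry c d q s row₂ q≤ s≤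
    where
    open ℕ.≤-Reasoning
    entry : ∀ α β x y → ∣ α ∣ ℕ.+ ∣ β ∣ ℕ.≤ k → ∣ x ∣ ℕ.≤ B → ∣ y ∣ ℕ.≤ B →
      ∣ α * x + β * y ∣ ℕ.≤ k ℕ.* B
    entry α β x y row x≤ y≤ = begin
      ∣ α * x + β * y ∣                    ≤⟨ ℤ.∣i+j∣≤∣i∣+∣j∣ (α * x) (β * y) ⟩
      ∣ α * x ∣ ℕ.+ ∣ β * y ∣              ≡⟨ cong₂ ℕ._+_ (ℤ.abs-* α x) (ℤ.abs-* β y) ⟩
      ∣ α ∣ ℕ.* ∣ x ∣ ℕ.+ ∣ β ∣ ℕ.* ∣ y ∣  ≤⟨ ℕ.+-mono-≤ (ℕ.*-monoʳ-≤ ∣ α ∣ x≤) (ℕ.*-monoʳ-≤ ∣ β ∣ y≤) ⟩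
      ∣ α ∣ ℕ.* B ℕ.+ ∣ β ∣ ℕ.* B          ≡⟨ ℕ.*-distribʳ-+ B ∣ α ∣ ∣ β ∣ ⟨
      (∣ α ∣ ℕ.+ ∣ β ∣) ℕ.* B              ≤⟨ ℕ.*-monoˡ-≤ B row ⟩
      k ℕ.* B                              ∎

  eval-entriesBounded : ∀ w → EntriesBounded (3 ^ length w) (eval w)
  eval-entriesBounded []      = s≤s z≤n , z≤n , z≤n , s≤s z≤n
  eval-entriesBounded (x ∷ w) = *ᴹ-entriesBounded (γ x) (eval w) (γ-rowSums≤3 x) (eval-entriesBounded w)

  ≡ᴹ-mod-small⇒≡ : ∀ {j B W} → B ℕ.+ 1 ℕ.< 2 ^ j → EntriesBounded B W → W ≡ᴹ I mod + (2 ^ j) → W ≡ I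
  ≡ᴹ-mod-small⇒≡ {j} {B} {mat a b c d} B+1<2^j (a≤ , b≤ , c≤ , d≤) (entrywise a≡ b≡ c≡ d≡) =
    mat-cong (entry 1ℤ a≡ a≤ (s≤s z≤n)) (entry 0ℤ b≡ b≤ z≤n) (entry 0ℤ c≡ c≤ z≤n) (entry 1ℤ d≡ d≤ (s≤s z≤n))
    where
    entry : ∀ δ {x} → x ≡ δ mod + (2 ^ j) → ∣ x ∣ ℕ.≤ B → ∣ δ ∣ ℕ.≤ 1 → x ≡ δ
    entry δ {x} x≡δ x≤ δ≤ =
      ≡-mod-small⇒≡ x≡δ (ℕ.≤-<-trans (ℕ.≤-trans (ℤ.∣i-j∣≤∣i∣+∣j∣ x δ) (ℕ.+-mono-≤ x≤ δ≤)) B+1<2^j)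

  no-short-relation-mod-2^ : ∀ j N {x w} → Linked _≢_ (x ∷ w) → 3 ^ length (x ∷ w) ℕ.+ 1 ℕ.< 2 ^ j →
    ¬ ((I +ᴹ + 2 • N) *ᴹ eval (x ∷ w) ≡ᴹ I +ᴹ + 2 • N mod + (2 ^ j))
  no-short-relation-mod-2^ j N {x} {w} reduced small MW≡M =
    eval-reduced≢I reduced (≡ᴹ-mod-small⇒≡ {j} small (eval-entriesBounded (x ∷ w)) W≡I)
    where
    M : Mat
    M = I +ᴹ + 2 • N
    W≡I : eval (x ∷ w) ≡ᴹ I mod + (2 ^ j)
    W≡I = odd-det-cancel-mod-2^ j (e₁₁ N + e₂₂ N + + 2 * det N) {M} (det-I+2• N)
            (≡ᴹ-mod-trans MW≡M (≡ᴹ-mod-reflexive (sym (*ᴹ-identityʳ M))))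

open FreeProduct

open import Data.List.Relation.Unary.AllPairs using (AllPairs; []; _∷_)
open import Data.Fin.Subset as Subset using ()
open import Data.Vec using (tabulate)
open import Data.Bool using (Bool; true; false; not; _∨_; if_then_else_)
open import Data.List.Relation.Unary.All using (All; []; _∷_)
open import Data.List.Relation.Unary.All.Properties using (All¬⇒¬Any)
open import Data.List.Relation.Unary.Any using (Any; here; there; any?)
open import Relation.Nullary.Decidable using (does; dec-true; dec-false; does-⇔; decidable-stable; toWitness)

private module _ {k : ℕ} {x : Fin (suc k)} where

  punchOutAll : ∀ {ys} → All (x ≢_) ys → List (Fin k)
  punchOutAll []          = []
  punchOutAll (x≢y ∷ x≢ys) = punchOut x≢y ∷ punchOutAll x≢ys

  length-punchOutAll : ∀ {ys} (x≢ys : All (x ≢_) ys) → length (punchOutAll x≢ys) ≡ length ys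
  length-punchOutAll []          = refl
  length-punchOutAll (_ ∷ x≢ys) = cong suc (length-punchOutAll x≢ys)

  punchOutAll-distinct : ∀ {ys} → AllPairs _≢_ ys → (x≢ys : All (x ≢_) ys) → AllPairs _≢_ (punchOutAll x≢ys)
  punchOutAll-distinct []              []            = []
  punchOutAll-distinct (y≢zs ∷ dist) (x≢y ∷ x≢zs) = punchOut-≢ y≢zs x≢zs ∷ punchOutAll-distinct dist x≢zs
    where
    punchOut-≢ : ∀ {zs} → All (_ ≢_) zs → (x≢zs : All (x ≢_) zs) → All (punchOut x≢y ≢_) (punchOutAll x≢zs)
    punchOut-≢ []            []            = []
    punchOut-≢ (y≢z ∷ y≢zs) (x≢z ∷ x≢zs) = (y≢z ∘ punchOut-injective x≢y x≢z) ∷ punchOut-≢ y≢zs x≢zs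

distinct⇒length≤ : ∀ {k} {xs : List (Fin k)} → AllPairs _≢_ xs → length xs ≤ k
distinct⇒length≤ {xs = []} _ = z≤n
distinct⇒length≤ {zero} {() ∷ _}
distinct⇒length≤ {suc k} {_ ∷ _} (x≢xs ∷ dist) =
  s≤s (subst (_≤ k) (length-punchOutAll x≢xs) (distinct⇒length≤ (punchOutAll-distinct dist x≢xs)))

∣tabulate-false∣ : ∀ n → Subset.∣ tabulate {n = n} (λ _ → false) ∣ ≡ 0
∣tabulate-false∣ zero    = refl
∣tabulate-false∣ (suc n) = ∣tabulate-false∣ n

∣tabulate-insert∣ : ∀ {n} (p : Fin n) (g : Fin n → Bool) → g p ≡ false →
  Subset.∣ tabulate (λ v → does (v ≟ p) ∨ g v) ∣ ≡ suc Subset.∣ tabulate g ∣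
∣tabulate-insert∣ Fin.zero    g gp rewrite gp = refl
∣tabulate-insert∣ {suc n} (Fin.suc p) g gp with g Fin.zero
... | true  = cong suc (∣tabulate-insert∣ {n} p (g ∘ Fin.suc) gp)
... | false = ∣tabulate-insert∣ {n} p (g ∘ Fin.suc) gp

∣tabulate-∈∣ : ∀ {n} {xs : List (Fin n)} → AllPairs _≢_ xs →
  Subset.∣ tabulate (λ v → does (any? (v ≟_) xs)) ∣ ≡ length xs
∣tabulate-∈∣ {n} {[]}    []             = ∣tabulate-false∣ n
∣tabulate-∈∣ {xs = x ∷ xs} (x≢xs ∷ dist) =
  trans (∣tabulate-insert∣ x (λ v → does (any? (v ≟_) xs)) (dec-false (any? (x ≟_) xs) (All¬⇒¬Any x≢xs)))
        (cong suc (∣tabulate-∈∣ dist))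

open import Data.Nat using (_+_; _*_; _<_)
open import Data.List.Relation.Unary.Linked using (Linked; [-]; _∷_)
open import Data.Bool.Properties using (not-¬; not-involutive)
open import Data.Nat.Divisibility using (_∣_; divides; ∣⇒≤)
open import Data.Nat.Primality using (Prime; prime?; euclidsLemma)
open import Algebra.Properties.CommutativeMonoid.Sum ℕ.+-0-commutativeMonoid using (sum; sum-cong-≗; ∑-distrib-+; sum-permute)
open import Algebra.Properties.Semiring.Sum ℕ.+-*-semiring using (*-distribˡ-sum)
open import Data.Fin.Permutation using (permutation)
open import Function using (_⇔_; mk⇔; _↔_; mk↔ₛ′; Inverse)

5-prime : Prime 5
5-prime = toWitness {a? = prime? 5} _

¬5∣2^ : ∀ j → ¬ 5 ∣ 2 ^ j
¬5∣2^ zero    5∣1 = contradiction (∣⇒≤ 5∣1) λ { (s≤s ()) }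
¬5∣2^ (suc j) 5∣2^[1+j] with euclidsLemma 2 (2 ^ j) 5-prime 5∣2^[1+j]
... | inj₁ 5∣2   = contradiction (∣⇒≤ 5∣2) λ { (s≤s (s≤s ())) }
... | inj₂ 5∣2^j = ¬5∣2^ j 5∣2^j

sum-const : ∀ n c → sum {n} (λ _ → c) ≡ n * c
sum-const zero    c = refl
sum-const (suc n) c = cong (c +_) (sum-const n c)

module Matchings {n : ℕ} (f : Gen → Fin n → Fin n) (f-involutive : ∀ x u → f x (f x u) ≡ u)
                 (side : Fin n → Bool) (side-f : ∀ x u → side (f x u) ≡ not (side u)) where

  infixl 5 _·_
  _·_ : Fin n → List Gen → Fin n
  u · []      = u
  u · (x ∷ w) = f x u · w

  Step : Fin n → Fin n → Set
  Step u v = Σ Gen λ x → v ≡ f x u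

  Step-sym : ∀ {u v} → Step u v → Step v u
  Step-sym {u} (x , refl) = x , sym (f-involutive x u)

  Step⇒side≢ : ∀ {u v} → Step u v → side u ≢ side v
  Step⇒side≢ {u} (x , refl) side≡ = not-¬ refl (trans side≡ (side-f x u))

  side-f-f : ∀ x y u → side (f y (f x u)) ≡ side u
  side-f-f x y u = trans (side-f y (f x u)) (trans (cong not (side-f x u)) (not-involutive (side u)))

  f-irreflexive : ∀ x u → f x u ≢ u
  f-irreflexive x u fxu≡u = Step⇒side≢ (x , sym fxu≡u) refl

  neighbours : Fin n → List (Fin n)
  neighbours u = f gA u ∷ f gB u ∷ f gC u ∷ []

  Any⇒Step : ∀ {u v} → Any (v ≡_) (neighbours u) → Step u v
  Any⇒Step (here v≡)                 = gA , v≡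
  Any⇒Step (there (here v≡))         = gB , v≡
  Any⇒Step (there (there (here v≡))) = gC , v≡

  Step⇒Any : ∀ {u v} → Step u v → Any (v ≡_) (neighbours u)
  Step⇒Any (gA , v≡) = here v≡
  Step⇒Any (gB , v≡) = there (here v≡)
  Step⇒Any (gC , v≡) = there (there (here v≡))

  adjacent : Fin n → Fin n → Bool
  adjacent u v = does (any? (v ≟_) (neighbours u))

  adjacent-sym : ∀ u v → adjacent u v ≡ adjacent v u
  adjacent-sym u v = does-⇔ (mk⇔ flip-edge flip-edge) (any? (v ≟_) (neighbours u)) (any? (u ≟_) (neighbours v))
    where
    flip-edge : ∀ {u v} → Any (v ≡_) (neighbours u) → Any (u ≡_) (neighbours v)
    flip-edge = Step⇒Any ∘ Step-sym ∘ Any⇒Step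

  adjacent-irrefl : ∀ v → adjacent v v ≡ false
  adjacent-irrefl v = dec-false (any? (v ≟_) (neighbours v)) λ v~v →
    let (x , v≡fxv) = Any⇒Step v~v in f-irreflexive x v (sym v≡fxv)

  graph : Graph n
  graph = record { adj = adjacent ; sym = adjacent-sym ; irrefl = adjacent-irrefl }

  Adj⇒Step : ∀ {u v} → Adj graph u v → Step u v
  Adj⇒Step {u} {v} u~v = Any⇒Step (decidable-stable v∈? λ v∉ → contradiction (trans (sym (dec-false v∈? v∉)) u~v) λ ())
    where
    v∈? : Dec (Any (v ≡_) (neighbours u))
    v∈? = any? (v ≟_) (neighbours u)

  Adj-f : ∀ x u → Adj graph u (f x u)
  Adj-f x u = dec-true (any? (f x u ≟_) (neighbours u)) (Step⇒Any (x , refl))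

  bipartite : Bipartite graph
  bipartite = side , λ u v u~v → Step⇒side≢ (Adj⇒Step u~v)

  NeighboursDistinct : Set
  NeighboursDistinct = ∀ {x y} u → x ≢ y → f x u ≢ f y u

  cubic : NeighboursDistinct → Cubic graph
  cubic f-distinct v = ∣tabulate-∈∣
    ((f-distinct v (λ ()) ∷ f-distinct v (λ ()) ∷ []) ∷ (f-distinct v (λ ()) ∷ []) ∷ [] ∷ [])

  record ReducedWalk (k : ℕ) (p : ℕ → Fin n) : Set where
    field
      first      : Gen
      rest       : List Gen
      reduced    : Linked _≢_ (first ∷ rest)
      length-rest : length rest ≡ k
      first-step : p 1 ≡ f first (p 0)
      walk       : p 0 · (first ∷ rest) ≡ p (suc k)
  open ReducedWalk

  reducedWalk : ∀ k (p : ℕ → Fin n) → (∀ i → i ≤ k → Step (p i) (p (suc i))) →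
    (∀ i → i < k → p i ≢ p (2 + i)) → ReducedWalk k p
  reducedWalk zero p step _ with step 0 z≤n
  ... | x , p₁≡ = record
    { first = x ; rest = [] ; reduced = [-] ; length-rest = refl ; first-step = p₁≡ ; walk = sym p₁≡ }
  reducedWalk (suc k) p step no-backtrack with step 0 z≤n
  ... | x , p₁≡ = record
    { first       = x
    ; rest        = first w ∷ rest w
    ; reduced     = x≢y ∷ reduced w
    ; length-rest = cong suc (length-rest w)
    ; first-step  = p₁≡
    ; walk        = trans (cong (_· (first w ∷ rest w)) (sym p₁≡)) (walk w)
    }
    where
    w : ReducedWalk k (λ i → p (suc i))
    w = reducedWalk k (λ i → p (suc i)) (λ i i≤k → step (suc i) (s≤s i≤k)) (λ i i<k → no-backtrack (suc i) (s≤s i<k))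
    x≢y : x ≢ first w
    x≢y refl = no-backtrack 0 (s≤s z≤n)
      (sym (trans (first-step w) (trans (cong (f x) p₁≡) (f-involutive x (p 0)))))

  NoShortClosedWalk : ℕ → Set
  NoShortClosedWalk g = ∀ {u x w} → Linked _≢_ (x ∷ w) → length (x ∷ w) < g → u · (x ∷ w) ≢ u

  module _ {m : ℕ} (cycle : Cycle graph m) where

    private
      L : ℕ
      L = 3 + m

      c : Fin L → Fin n
      c = proj₁ cycle

      c-injective : ∀ {i j} → c i ≡ c j → i ≡ j
      c-injective = proj₁ (proj₂ cycle)

      wrap : ℕ → Fin L
      wrap i with i ℕ.<? L
      ... | yes i<L = fromℕ< i<L
      ... | no _    = Fin.zero

      toℕ-wrap : ∀ {i} → i < L → toℕ (wrap i) ≡ i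
      toℕ-wrap {i} i<L with i ℕ.<? L
      ... | yes i<L′ = Fin.toℕ-fromℕ< i<L′
      ... | no i≮L   = contradiction i<L i≮L

      wrap-L : wrap L ≡ Fin.zero
      wrap-L with L ℕ.<? L
      ... | yes L<L = contradiction L<L (ℕ.<-irrefl refl)
      ... | no _    = refl

      p : ℕ → Fin n
      p i = c (wrap i)

      step : ∀ i → i ≤ 2 + m → Step (p i) (p (suc i))
      step i i≤2+m with ℕ.m≤n⇒m<n∨m≡n i≤2+m
      ... | inj₁ i<2+m =
        Adj⇒Step (subst₂ (λ a b → Adj graph (c a) (c b)) (Fin.toℕ-injective inject₁j≡i) (Fin.toℕ-injective 1+j≡1+i)
                         (proj₁ (proj₂ (proj₂ cycle)) j))
        where
        j : Fin (2 + m)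
        j = fromℕ< i<2+m
        inject₁j≡i : toℕ (inject₁ j) ≡ toℕ (wrap i)
        inject₁j≡i = trans (Fin.toℕ-inject₁ j) (trans (Fin.toℕ-fromℕ< i<2+m) (sym (toℕ-wrap (ℕ.m<n⇒m<1+n i<2+m))))
        1+j≡1+i : toℕ (Fin.suc j) ≡ toℕ (wrap (suc i))
        1+j≡1+i = trans (cong suc (Fin.toℕ-fromℕ< i<2+m)) (sym (toℕ-wrap (s≤s i<2+m)))
      ... | inj₂ refl =
        Adj⇒Step (subst₂ (λ a b → Adj graph (c a) (c b)) (Fin.toℕ-injective last≡) (sym wrap-L) (proj₂ (proj₂ (proj₂ cycle))))
        where
        last≡ : toℕ (fromℕ (2 + m)) ≡ toℕ (wrap (2 + m))
        last≡ = trans (Fin.toℕ-fromℕ (2 + m)) (sym (toℕ-wrap (ℕ.n<1+n (2 + m))))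

      no-backtrack : ∀ i → i < 2 + m → p i ≢ p (2 + i)
      no-backtrack i i<2+m pi≡p2+i with ℕ.m≤n⇒m<n∨m≡n (s≤s i<2+m)
      ... | inj₁ 2+i<L = ℕ.m≢1+n+m i (begin
        i                   ≡⟨ toℕ-wrap (ℕ.m<n⇒m<1+n i<2+m) ⟨
        toℕ (wrap i)        ≡⟨ cong toℕ (c-injective pi≡p2+i) ⟩
        toℕ (wrap (2 + i))  ≡⟨ toℕ-wrap 2+i<L ⟩
        2 + i               ∎)
        where open ≡-Reasoning
      ... | inj₂ refl = ℕ.1+n≢0 (begin
        suc m               ≡⟨ toℕ-wrap (ℕ.m<n⇒m<1+n i<2+m) ⟨
        toℕ (wrap (suc m))  ≡⟨ cong toℕ (c-injective (trans pi≡p2+i (cong c wrap-L))) ⟩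
        0                   ∎)
        where open ≡-Reasoning

      closes : p L ≡ p 0
      closes = cong c (trans wrap-L (sym (Fin.toℕ-injective (toℕ-wrap (s≤s z≤n)))))

    cycle-length≥ : ∀ g → NoShortClosedWalk g → g ≤ 3 + m
    cycle-length≥ g no-short = ℕ.≮⇒≥ λ L<g →
      no-short (reduced w) (subst (_< g) (cong suc (sym (length-rest w))) L<g) (trans (walk w) closes)
      where
      w : ReducedWalk (2 + m) p
      w = reducedWalk (2 + m) p step no-backtrack

  girth : ∀ g → NoShortClosedWalk g → GirthAtLeast graph g
  girth g no-short m cycle = cycle-length≥ cycle g no-short

  module StrongColouring (f-distinct : NeighboursDistinct)
                         {k : ℕ} (φ : EdgeColouring graph k) (proper : Proper φ) (strong : NoBichromaticP3 φ) where

    colour : Gen → Fin n → Fin k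
    colour x u = col φ u (f x u)

    colour-≢ : ∀ {x y} u → x ≢ y → colour x u ≢ colour y u
    colour-≢ u x≢y = proper u _ _ (Adj-f _ u) (Adj-f _ u) (f-distinct u x≢y)

    colour-f : ∀ x u → colour x (f x u) ≡ colour x u
    colour-f x u = trans (cong (col φ (f x u)) (f-involutive x u)) (colSym φ (f x u) u)

    colour-across : ∀ {x y y′} u → y ≢ x → y′ ≢ x → colour y u ≢ colour y′ (f x u)
    colour-across {x} {y} {y′} u y≢x y′≢x same = strong a u v d a≢u a≢v a≢d u≢v u≢d v≢d a~u (Adj-f x u) (Adj-f y′ v)
      (trans (colSym φ a u) same)
      where
      v a d : Fin n
      v = f x u
      a = f y u
      d = f y′ v
      a≢u : a ≢ u
      a≢u = f-irreflexive y u
      a≢v : a ≢ v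
      a≢v = f-distinct u y≢x
      a≢d : a ≢ d
      a≢d a≡d = Step⇒side≢ (y , refl) (trans (sym (side-f-f x y′ u)) (cong side (sym a≡d)))
      u≢v : u ≢ v
      u≢v u≡v = f-irreflexive x u (sym u≡v)
      u≢d : u ≢ d
      u≢d u≡d = f-distinct v (y′≢x ∘ sym) (trans (f-involutive x u) u≡d)
      v≢d : v ≢ d
      v≢d v≡d = f-irreflexive y′ v (sym v≡d)
      a~u : Adj graph a u
      a~u = subst (Adj graph a) (f-involutive y u) (Adj-f y a)

    colours-around-edge : ∀ {x y z} u → x ≢ y → x ≢ z → y ≢ z →
      AllPairs _≢_ (colour x u ∷ colour y u ∷ colour z u ∷ colour y (f x u) ∷ colour z (f x u) ∷ [])
    colours-around-edge {x} {y} {z} u x≢y x≢z y≢z =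
      (colour-≢ u x≢y ∷ colour-≢ u x≢z ∷ edge≢ x≢y ∷ edge≢ x≢z ∷ []) ∷
      (colour-≢ u y≢z ∷ colour-across u y≢x y≢x ∷ colour-across u y≢x z≢x ∷ []) ∷
      (colour-across u z≢x y≢x ∷ colour-across u z≢x z≢x ∷ []) ∷
      (colour-≢ (f x u) y≢z ∷ []) ∷ [] ∷ []
      where
      y≢x : y ≢ x
      y≢x = x≢y ∘ sym
      z≢x : z ≢ x
      z≢x = x≢z ∘ sym
      edge≢ : ∀ {w} → x ≢ w → colour x u ≢ colour w (f x u)
      edge≢ x≢w same = colour-≢ (f x u) x≢w (trans (colour-f x u) same)

    at-least-five-colours : Fin n → 5 ≤ k
    at-least-five-colours u = distinct⇒length≤ (colours-around-edge {gA} {gB} {gC} u (λ ()) (λ ()) (λ ()))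

  ∑Gen : (Gen → ℕ) → ℕ
  ∑Gen h = h gA + (h gB + h gC)

  ∑Gen-cong : ∀ {h h′} → (∀ x → h x ≡ h′ x) → ∑Gen h ≡ ∑Gen h′
  ∑Gen-cong h≗h′ = cong₂ _+_ (h≗h′ gA) (cong₂ _+_ (h≗h′ gB) (h≗h′ gC))

  sum-∑Gen : ∀ (h : Gen → Fin n → ℕ) → sum (λ u → ∑Gen (λ x → h x u)) ≡ ∑Gen (λ x → sum (h x))
  sum-∑Gen h = trans (∑-distrib-+ (h gA) _) (cong (sum (h gA) +_) (∑-distrib-+ (h gB) (h gC)))

  indicator : Bool → ℕ
  indicator b = if b then 1 else 0

  module FiveColours (f-distinct : NeighboursDistinct)
                     (φ : EdgeColouring graph 5) (proper : Proper φ) (strong : NoBichromaticP3 φ) where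

    open StrongColouring f-distinct φ proper strong
    open ≡-Reasoning

    Incident : Fin 5 → Fin n → Set
    Incident t u = Σ Gen λ x → colour x u ≡ t

    incident? : ∀ t u → Dec (Incident t u)
    incident? t u with colour gA u Fin.≟ t | colour gB u Fin.≟ t | colour gC u Fin.≟ t
    ... | yes a≡t | _       | _       = yes (gA , a≡t)
    ... | no _    | yes b≡t | _       = yes (gB , b≡t)
    ... | no _    | no _    | yes c≡t = yes (gC , c≡t)
    ... | no a≢t  | no b≢t  | no c≢t  = no λ where
      (gA , a≡t) → a≢t a≡t
      (gB , b≡t) → b≢t b≡t
      (gC , c≡t) → c≢t c≡t

    incident-f : ∀ {t u x₀} → colour x₀ u ≡ t → ∀ x → Incident t (f x u) ⇔ x ≡ x₀
    incident-f {t} {u} {x₀} x₀≡t x = mk⇔ to λ where refl → x₀ , trans (colour-f x₀ u) x₀≡t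
      where
      to : Incident t (f x u) → x ≡ x₀
      to (y , y≡t) with x ≟ᴳ x₀ | y ≟ᴳ x
      ... | yes x≡x₀ | _        = x≡x₀
      ... | no x≢x₀  | yes refl = contradiction (trans (sym (colour-f x u)) (trans y≡t (sym x₀≡t))) (colour-≢ u x≢x₀)
      ... | no x≢x₀  | no y≢x   =
        contradiction (trans x₀≡t (sym y≡t)) (colour-across u (x≢x₀ ∘ sym) y≢x)

    neighbour-incident : ∀ {t u} → ¬ Incident t u → ∀ {x y z} → x ≢ y → x ≢ z → y ≢ z → Incident t (f x u)
    neighbour-incident {t} {u} t∉u {x} {y} {z} x≢y x≢z y≢z with t Fin.≟ colour y (f x u) | t Fin.≟ colour z (f x u)
    ... | yes t≡y′ | _        = y , sym t≡y′
    ... | no _     | yes t≡z′ = z , sym t≡z′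
    ... | no t≢y′  | no t≢z′  = contradiction (distinct⇒length≤ six-distinct) (ℕ.<-irrefl refl)
      where
      t≢ : ∀ w → t ≢ colour w u
      t≢ w t≡w = t∉u (w , sym t≡w)
      six-distinct : AllPairs _≢_ (t ∷ colour x u ∷ colour y u ∷ colour z u ∷ colour y (f x u) ∷ colour z (f x u) ∷ [])
      six-distinct = (t≢ x ∷ t≢ y ∷ t≢ z ∷ t≢y′ ∷ t≢z′ ∷ []) ∷ colours-around-edge u x≢y x≢z y≢z

    unincident-f : ∀ {t u} → ¬ Incident t u → ∀ x → Incident t (f x u)
    unincident-f t∉u gA = neighbour-incident t∉u {gA} {gB} {gC} (λ ()) (λ ()) (λ ())
    unincident-f t∉u gB = neighbour-incident t∉u {gB} {gA} {gC} (λ ()) (λ ()) (λ ())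
    unincident-f t∉u gC = neighbour-incident t∉u {gC} {gA} {gB} (λ ()) (λ ()) (λ ())

    module Crossings (t : Fin 5) where

      inc : Fin n → Bool
      inc u = does (incident? t u)

      -- crossing (inc u) (inc v) counts an edge uv leaving the vertices incident with t.
      crossing : Bool → Bool → ℕ
      crossing true false = 1
      crossing _    _     = 0

      inc-f-incident : ∀ {u x₀} → colour x₀ u ≡ t → ∀ x → inc (f x u) ≡ does (x ≟ᴳ x₀)
      inc-f-incident {u} {x₀} x₀≡t x = does-⇔ (incident-f x₀≡t x) (incident? t (f x u)) (x ≟ᴳ x₀)

      inc-f-unincident : ∀ {u} → ¬ Incident t u → ∀ x → inc (f x u) ≡ true
      inc-f-unincident {u} t∉u x = dec-true (incident? t (f x u)) (unincident-f t∉u x)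

      χ χ̄ : Fin n → ℕ
      χ u = indicator (inc u)
      χ̄ u = indicator (not (inc u))

      out-degree : ∀ u → ∑Gen (λ x → crossing (inc u) (inc (f x u))) ≡ 2 * χ u
      out-degree u with incident? t u
      ... | yes (x₀ , x₀≡t) = trans (∑Gen-cong (λ x → cong (crossing true) (inc-f-incident x₀≡t x))) (two-others x₀)
        where
        two-others : ∀ x₀ → ∑Gen (λ x → crossing true (does (x ≟ᴳ x₀))) ≡ 2
        two-others gA = refl
        two-others gB = refl
        two-others gC = refl
      ... | no t∉u = ∑Gen-cong (λ x → cong (crossing false) (inc-f-unincident t∉u x))

      in-degree : ∀ u → ∑Gen (λ x → crossing (inc (f x u)) (inc u)) ≡ 3 * χ̄ u
      in-degree u with incident? t u
      ... | yes (x₀ , x₀≡t) = trans (∑Gen-cong (λ x → cong (λ b → crossing b true) (inc-f-incident x₀≡t x))) (none x₀)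
        where
        none : ∀ x₀ → ∑Gen (λ x → crossing (does (x ≟ᴳ x₀)) true) ≡ 0
        none gA = refl
        none gB = refl
        none gC = refl
      ... | no t∉u = ∑Gen-cong (λ x → cong (λ b → crossing b false) (inc-f-unincident t∉u x))

      cut-balance : ∀ x → sum (λ u → crossing (inc u) (inc (f x u))) ≡ sum (λ u → crossing (inc (f x u)) (inc u))
      cut-balance x = trans (sum-permute _ (permutation (f x) (f x) (f-involutive x) (f-involutive x)))
                            (sum-cong-≗ λ u → cong (crossing (inc (f x u))) (cong inc (f-involutive x u)))

      3χ̄≡2χ : sum (λ u → 3 * χ̄ u) ≡ sum (λ u → 2 * χ u)
      3χ̄≡2χ = begin
        sum (λ u → 3 * χ̄ u)                                      ≡⟨ sum-cong-≗ in-degree ⟨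
        sum (λ u → ∑Gen (λ x → crossing (inc (f x u)) (inc u)))  ≡⟨ sum-∑Gen (λ x u → crossing (inc (f x u)) (inc u)) ⟩
        ∑Gen (λ x → sum (λ u → crossing (inc (f x u)) (inc u)))  ≡⟨ ∑Gen-cong cut-balance ⟨
        ∑Gen (λ x → sum (λ u → crossing (inc u) (inc (f x u))))  ≡⟨ sum-∑Gen (λ x u → crossing (inc u) (inc (f x u))) ⟨
        sum (λ u → ∑Gen (λ x → crossing (inc u) (inc (f x u))))  ≡⟨ sum-cong-≗ out-degree ⟩
        sum (λ u → 2 * χ u)                                      ∎

      3n≡5·∑χ : 3 * n ≡ 5 * sum χ
      3n≡5·∑χ = begin
        3 * n                                             ≡⟨ ℕ.*-comm 3 n ⟩
        n * 3                                             ≡⟨ sum-const n 3 ⟨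
        sum {n} (λ _ → 3)                                 ≡⟨ sum-cong-≗ (λ u → split (inc u)) ⟩
        sum (λ u → 3 * χ̄ u + 3 * χ u)                     ≡⟨ ∑-distrib-+ (λ u → 3 * χ̄ u) (λ u → 3 * χ u) ⟩
        sum (λ u → 3 * χ̄ u) + sum (λ u → 3 * χ u)         ≡⟨ cong (_+ sum (λ u → 3 * χ u)) 3χ̄≡2χ ⟩
        sum (λ u → 2 * χ u) + sum (λ u → 3 * χ u)         ≡⟨ ∑-distrib-+ (λ u → 2 * χ u) (λ u → 3 * χ u) ⟨
        sum (λ u → 2 * χ u + 3 * χ u)                     ≡⟨ sum-cong-≗ (λ u → ℕ.*-distribʳ-+ (χ u) 2 3) ⟨
        sum (λ u → 5 * χ u)                               ≡⟨ *-distribˡ-sum 5 χ ⟨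
        5 * sum χ                                         ∎
        where
        split : ∀ b → 3 ≡ 3 * indicator (not b) + 3 * indicator b
        split true  = refl
        split false = refl

    five-colours⇒5∣n : 5 ∣ n
    five-colours⇒5∣n with euclidsLemma 3 n 5-prime 5∣3n
      where
      open Crossings Fin.zero
      5∣3n : 5 ∣ 3 * n
      5∣3n = divides (sum χ) (trans 3n≡5·∑χ (ℕ.*-comm 5 (sum χ)))
    ... | inj₁ 5∣3 = contradiction (∣⇒≤ 5∣3) λ { (s≤s (s≤s (s≤s ()))) }
    ... | inj₂ 5∣n = 5∣n

  strongChromaticIndex≥6 : NeighboursDistinct → Fin n → ¬ 5 ∣ n → StrongChromaticIndexAtLeast graph 6
  strongChromaticIndex≥6 f-distinct u 5∤n k k<6 (φ , proper , strong) with ℕ.m≤n⇒m<n∨m≡n (ℕ.s≤s⁻¹ k<6)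
  ... | inj₁ k<5  = ℕ.<⇒≱ k<5 (StrongColouring.at-least-five-colours f-distinct φ proper strong u)
  ... | inj₂ refl = 5∤n (FiveColours.five-colours⇒5∣n f-distinct φ proper strong)

open import Data.Fin.Properties using (*↔×; 2↔Bool)
open import Data.Product.Function.NonDependent.Propositional using (_×-↔_)
open import Function.Construct.Composition using (_↔-∘_)
open import Function.Construct.Identity using (↔-id)
import Relation.Binary.Reasoning.Setoid as SetoidReasoning

Mat₂↔ : ∀ {A : Set} → (A × A × A × A) ↔ Mat₂ A
Mat₂↔ = mk↔ₛ′ (λ (a , b , c , d) → mat a b c d) (λ (mat a b c d) → a , b , c , d) (λ _ → refl) (λ _ → refl)

module CongruenceGraph (K : ℕ) where

  open import Data.Integer as ℤ using (ℤ; +_)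
  import Data.Integer.Properties as ℤ

  m : ℕ
  m = 2 ^ K

  instance
    m-nonZero : NonZero m
    m-nonZero = ℕ.m^n≢0 2 K

  modulus : ℤ
  modulus = + (2 ^ suc K)

  -- (s , N) stands for the matrix I + 2N modulo 2^(K+1), on side s of the double cover.
  Vertex : Set
  Vertex = Bool × Mat₂ (Fin m)

  n : ℕ
  n = 2 * (m * (m * (m * m)))

  Fin↔Vertex : Fin n ↔ Vertex
  Fin↔Vertex = (2↔Bool ×-↔ Fin↔Mat₂) ↔-∘ *↔×
    where
    Fin↔Mat₂ : Fin (m * (m * (m * m))) ↔ Mat₂ (Fin m)
    Fin↔Mat₂ = Mat₂↔ ↔-∘ ((↔-id _ ×-↔ (↔-id _ ×-↔ *↔×)) ↔-∘ ((↔-id _ ×-↔ *↔×) ↔-∘ *↔×))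

  lift : Mat₂ (Fin m) → Mat
  lift = map₂ (λ i → + toℕ i)

  matrix : Vertex → Mat
  matrix (_ , N) = I +ᴹ + 2 • lift N

  step : Gen → Vertex → Vertex
  step x (s , N) = not s , map₂ (reduce m) (lift N +ᴹ X x +ᴹ + 2 • (lift N *ᴹ X x))

  lift-reduce : ∀ A → lift (map₂ (reduce m) A) ≡ᴹ A mod + m
  lift-reduce (mat a b c d) = entrywise (reduced a) (reduced b) (reduced c) (reduced d)
    where
    reduced : ∀ x → + toℕ (reduce m x) ≡ x mod + m
    reduced x = ≡-mod-sym (≡-mod-reduce m x)

  2m≡modulus : + 2 ℤ.* + m ≡ modulus
  2m≡modulus = sym (ℤ.pos-* 2 m)

  matrix-step : ∀ x v → matrix (step x v) ≡ᴹ matrix v *ᴹ γ x mod modulus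
  matrix-step x (s , N) = ≡ᴹ-mod-trans
    (≡ᴹ-mod-cast 2m≡modulus (I+2•-cong-mod (lift-reduce Y)))
    (≡ᴹ-mod-reflexive (sym (I+2•-*ᴹ (lift N) (X x))))
    where
    Y : Mat
    Y = lift N +ᴹ X x +ᴹ + 2 • (lift N *ᴹ X x)

  lift-injective : ∀ {N N′} → lift N ≡ᴹ lift N′ mod + m → N ≡ N′
  lift-injective {mat _ _ _ _} {mat _ _ _ _} (entrywise a b c d) =
    mat-cong (toℕ-cong-mod⇒≡ a) (toℕ-cong-mod⇒≡ b) (toℕ-cong-mod⇒≡ c) (toℕ-cong-mod⇒≡ d)

  matrix-injective : ∀ {v v′} → proj₁ v ≡ proj₁ v′ → matrix v ≡ᴹ matrix v′ mod modulus → v ≡ v′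
  matrix-injective {s , N} {.s , N′} refl M≡M′ =
    cong (s ,_) (lift-injective (I+2•-cancel-mod (≡ᴹ-mod-cast (sym 2m≡modulus) M≡M′)))

  step-involutive : ∀ x v → step x (step x v) ≡ v
  step-involutive x v = matrix-injective (not-involutive (proj₁ v)) (begin
    matrix (step x (step x v))    ≈⟨ matrix-step x (step x v) ⟩
    matrix (step x v) *ᴹ γ x      ≈⟨ *ᴹ-cong-mod (matrix-step x v) (≡ᴹ-mod-refl {A = γ x}) ⟩
    matrix v *ᴹ γ x *ᴹ γ x        ≡⟨ *ᴹ-assoc (matrix v) (γ x) (γ x) ⟩
    matrix v *ᴹ (γ x *ᴹ γ x)      ≡⟨ cong (matrix v *ᴹ_) (γ-involutive x) ⟩
    matrix v *ᴹ I                 ≡⟨ *ᴹ-identityʳ (matrix v) ⟩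
    matrix v                      ∎)
    where open SetoidReasoning (≡ᴹ-mod-setoid modulus)

  open Inverse Fin↔Vertex using (to; from; strictlyInverseˡ; strictlyInverseʳ)

  f : Gen → Fin n → Fin n
  f x u = from (step x (to u))

  f-involutive : ∀ x u → f x (f x u) ≡ u
  f-involutive x u = begin
    from (step x (to (from (step x (to u)))))  ≡⟨ cong (from ∘ step x) (strictlyInverseˡ (step x (to u))) ⟩
    from (step x (step x (to u)))              ≡⟨ cong from (step-involutive x (to u)) ⟩
    from (to u)                                ≡⟨ strictlyInverseʳ u ⟩
    u                                          ∎
    where open ≡-Reasoning

  side : Fin n → Bool
  side u = proj₁ (to u)

  side-f : ∀ x u → side (f x u) ≡ not (side u)
  side-f x u = cong proj₁ (strictlyInverseˡ (step x (to u)))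

  open Matchings f f-involutive side side-f public

  matrix-walk : ∀ u w → matrix (to (u · w)) ≡ᴹ matrix (to u) *ᴹ eval w mod modulus
  matrix-walk u []      = ≡ᴹ-mod-reflexive (sym (*ᴹ-identityʳ (matrix (to u))))
  matrix-walk u (x ∷ w) = begin
    matrix (to (f x u · w))                    ≈⟨ matrix-walk (f x u) w ⟩
    matrix (to (f x u)) *ᴹ eval w              ≡⟨ cong (λ v → matrix v *ᴹ eval w) (strictlyInverseˡ (step x (to u))) ⟩
    matrix (step x (to u)) *ᴹ eval w           ≈⟨ *ᴹ-cong-mod (matrix-step x (to u)) (≡ᴹ-mod-refl {A = eval w}) ⟩
    matrix (to u) *ᴹ γ x *ᴹ eval w             ≡⟨ *ᴹ-assoc (matrix (to u)) (γ x) (eval w) ⟩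
    matrix (to u) *ᴹ eval (x ∷ w)              ∎
    where open SetoidReasoning (≡ᴹ-mod-setoid modulus)

  short-reduced-walk-not-closed : ∀ {u x w} → Linked _≢_ (x ∷ w) → 3 ^ length (x ∷ w) + 1 < 2 ^ suc K →
    u · (x ∷ w) ≢ u
  short-reduced-walk-not-closed {u} {x} {w} reduced short closed =
    no-short-relation-mod-2^ (suc K) (lift (proj₂ (to u))) reduced short
      (≡ᴹ-mod-trans (≡ᴹ-mod-sym (matrix-walk u (x ∷ w))) (≡ᴹ-mod-reflexive (cong (matrix ∘ to) closed)))

  f-distinct : 3 ^ 2 + 1 < 2 ^ suc K → NeighboursDistinct
  f-distinct short {x} {y} u x≢y fx≡fy = short-reduced-walk-not-closed (x≢y ∷ [-]) short
    (trans (cong (f y) fx≡fy) (f-involutive y u))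

  ¬5∣n : ¬ 5 ∣ n
  ¬5∣n = subst (λ k → ¬ 5 ∣ k) (sym n≡2^) (¬5∣2^ (suc (K + (K + (K + K)))))
    where
    n≡2^ : n ≡ 2 ^ suc (K + (K + (K + K)))
    n≡2^ = cong (2 *_) (sym (trans (ℕ.^-distribˡ-+-* 2 K _) (cong (m *_)
             (trans (ℕ.^-distribˡ-+-* 2 K _) (cong (m *_) (ℕ.^-distribˡ-+-* 2 K K))))))

  some-vertex : Fin n
  some-vertex = from (false , mat 0ᶠ 0ᶠ 0ᶠ 0ᶠ)
    where
    0ᶠ : Fin m
    0ᶠ = fromℕ< (ℕ.m^n>0 2 K)

3^L+1<2^[2+2M] : ∀ {L M} → L ≤ M → 3 ^ L + 1 < 2 ^ suc (suc (2 * M))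
3^L+1<2^[2+2M] {L} {M} L≤M = begin-strict
  3 ^ L + 1                  ≤⟨ ℕ.+-mono-≤ (ℕ.^-monoˡ-≤ L 3≤4) (ℕ.m^n>0 4 L) ⟩
  4 ^ L + 4 ^ L              ≡⟨ cong (λ k → k + k) (ℕ.^-*-assoc 2 2 L) ⟩
  2 ^ (2 * L) + 2 ^ (2 * L)  ≡⟨ cong (2 ^ (2 * L) +_) (ℕ.+-identityʳ (2 ^ (2 * L))) ⟨
  2 ^ suc (2 * L)            ≤⟨ ℕ.^-monoʳ-≤ 2 (s≤s (ℕ.*-monoʳ-≤ 2 L≤M)) ⟩
  2 ^ suc (2 * M)            <⟨ ℕ.^-monoʳ-< 2 (s≤s (s≤s z≤n)) (ℕ.n<1+n (suc (2 * M))) ⟩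
  2 ^ suc (suc (2 * M))      ∎
  where
  open ℕ.≤-Reasoning
  3≤4 : 3 ≤ 4
  3≤4 = s≤s (s≤s (s≤s z≤n))

theorem6 : (g : ℕ) → Σ ℕ λ n → Σ (Graph n) λ G →
    Bipartite G × Cubic G × GirthAtLeast G g × StrongChromaticIndexAtLeast G 6
theorem6 g =
  n , graph , bipartite , cubic (f-distinct short₂) ,
  girth g (λ reduced L<g → short-reduced-walk-not-closed reduced (short (ℕ.<⇒≤ L<g))) ,
  strongChromaticIndex≥6 (f-distinct short₂) some-vertex ¬5∣n
  where
  M : ℕ
  M = g + 2
  open CongruenceGraph (suc (2 * M))
  short : ∀ {L} → L ≤ g → 3 ^ L + 1 < 2 ^ suc (suc (2 * M))
  short L≤g = 3^L+1<2^[2+2M] (ℕ.≤-trans L≤g (ℕ.m≤m+n g 2))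
  short₂ : 3 ^ 2 + 1 < 2 ^ suc (suc (2 * M))
  short₂ = 3^L+1<2^[2+2M] (ℕ.m≤n+m 2 g)
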